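{- Let $G=(V,E)$ be a graph. Then $V$ can be partitioned into three sets $V_1,V_2,V_3$ such that each $G[V_i]$ is a clique if and only if $G$ has three pairwise vertex-disjoint subgraphs whose densities sum to at least $(|V|-3)/2$.
   Context: Graphs are finite, simple, undirected. Subgraphs are induced subgraphs $G[U]$ on nonempty vertex sets $U$ (density is only defined for graphs with at least one vertex); the parts of a partition are nonempty. The density of a graph with $n'\ge1$ vertices and $m'$ edges is $m'/n'$. -}

module Defs where

open import Data.Nat using (ℕ; zero; suc; _<ᵇ_)
open import Data.Bool using (Bool; true; false; _∧_; if_then_else_)
open import Data.Fin using (Fin; toℕ)
open import Data.Fin.Subset using (Subset; _∈_; ∣_∣; Nonempty)
open import Data.Vec using (lookup)
open import Data.List using (List; map; allFin)
open import Data.Nat.ListAction using (sum)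
open import Data.Integer using (ℤ; +_)
open import Data.Rational using (ℚ; _/_; 0ℚ)
open import Data.Product using (_×_)
open import Data.Sum using (_⊎_)
open import Data.Empty using (⊥)
open import Relation.Binary.PropositionalEquality using (_≡_; _≢_)

record Graph (n : ℕ) : Set where
  field
    adj    : Fin n → Fin n → Bool
    sym    : ∀ i j → adj i j ≡ adj j i
    irrefl : ∀ i → adj i i ≡ false
open Graph public

-- number of edges of the induced subgraph G[U]: unordered pairs {i,j}
-- (counted once, via toℕ i < toℕ j) with i, j ∈ U and ij an edge.
edges : ∀ {n} → Graph n → Subset n → ℕ
edges {n} G U =
  sum (map (λ i → sum (map (λ j →
        if (toℕ i <ᵇ toℕ j) ∧ lookup U i ∧ lookup U j ∧ adj G i j
        then 1 else 0) (allFin n))) (allFin n))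

-- density m'/n' of G[U]; only used for nonempty U (value 0 for empty U is
-- an irrelevant convention).
density : ∀ {n} → Graph n → Subset n → ℚ
density G U with ∣ U ∣
... | zero  = 0ℚ
... | suc k = (+ edges G U) / suc k

Disjoint : ∀ {n} → Subset n → Subset n → Set
Disjoint A B = ∀ v → v ∈ A → v ∈ B → ⊥

IsClique : ∀ {n} → Graph n → Subset n → Set
IsClique G U = ∀ i j → i ∈ U → j ∈ U → i ≢ j → adj G i j ≡ true

ThreeDisjoint : ∀ {n} → Subset n → Subset n → Subset n → Set
ThreeDisjoint A B C =
  Nonempty A × Nonempty B × Nonempty C ×
  Disjoint A B × Disjoint A C × Disjoint B C

IsPartition3 : ∀ {n} → Subset n → Subset n → Subset n → Set
IsPartition3 A B C = ThreeDisjoint A B C × (∀ v → v ∈ A ⊎ v ∈ B ⊎ v ∈ C)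

-- A set of k + 1 vertices spans at most k(k + 1)/2 edges, so its density is at most k/2,
-- with equality exactly when it is a clique. Three disjoint nonempty sets of sizes
-- k₁ + 1, k₂ + 1, k₃ + 1 therefore have densities summing to at most
-- (k₁ + k₂ + k₃)/2 ≤ (n − 3)/2, and (n − 3)/2 is reached exactly when all three sets
-- are cliques and together they cover all n vertices.

module Submission where

open import Defs hiding (sym)
open import Data.Nat using (ℕ)
open import Data.Fin.Subset using (Subset)
open import Data.Integer using (+_; _-_)
open import Data.Rational using (_≤_; _+_; _/_)
open import Data.Product using (Σ-syntax; _×_)
open import Function.Bundles using (_⇔_)

import Data.Nat.Properties as ℕ
open import Algebra.Properties.CommutativeMonoid.Sum ℕ.+-0-commutativeMonoid
  using (sum; sum-syntax; sum-cong-≗; sum-replicate-zero)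
open import Data.Bool using (Bool; true; false; T; _∧_; if_then_else_)
open import Data.Bool.Properties using (∧-assoc; T-≡; T-∧)
open import Data.Empty using (⊥-elim)
open import Data.Fin using (Fin; toℕ; zero; suc)
open import Data.Fin.Properties using (toℕ-injective)
open import Data.Fin.Subset using (_∈_; _∪_; ∣_∣; Nonempty)
open import Data.Fin.Subset.Properties using (x∈p∪q⁺; x∈p∪q⁻; ∣p∣≤n; ∣⊤∣≡n; ∣p∣≡n⇒p≡⊤; ∈⊤; ⊆⊤; ⊆-antisym)
open import Data.Integer as ℤ using (ℤ)
import Data.Integer.Properties as ℤ
open import Data.Integer.Solver renaming (module +-*-Solver to ℤ-Solver)
open import Data.List using (map; tabulate)
import Data.Nat as ℕ
open import Data.Nat using (zero; suc; _<ᵇ_; z≤n)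
open import Data.Nat.ListAction using () renaming (sum to sumᴸ)
open import Data.Nat.Solver using (module +-*-Solver)
open import Data.Product using (∃-syntax; _,_; proj₁; proj₂)
open import Data.Rational using (ℚ; toℚᵘ)
open import Data.Rational.Properties
  using (≤-trans; ≤-antisym; ≤-reflexive; ≮⇒≥; <-irrefl; <-≤-trans; +-mono-≤; +-mono-<-≤; +-mono-≤-<;
         toℚᵘ-fromℚᵘ; toℚᵘ-mono-≤; toℚᵘ-cancel-≤; toℚᵘ-injective; toℚᵘ-homo-+)
open import Data.Rational.Unnormalised as ℚᵘ using (mkℚᵘ; *≡*; *≤*)
import Data.Rational.Unnormalised.Properties as ℚᵘ
open import Data.Sum using (_⊎_)
import Data.Sum as Sum
open import Data.Vec using ([]; _∷_; lookup; here; there)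
open import Data.Vec.Properties using ([]=⇒lookup; lookup⇒[]=)
open import Function using (_∘_; id)
open import Function.Bundles using (mk⇔; Equivalence)
open import Relation.Binary using (tri<; tri≈; tri>)
open import Relation.Binary.PropositionalEquality

open Equivalence using (to; from)

private variable
  n : ℕ

∑-mono-≤ : {f g : Fin n → ℕ} → (∀ i → f i ℕ.≤ g i) → sum f ℕ.≤ sum g
∑-mono-≤ {zero}  f≤g = z≤n
∑-mono-≤ {suc n} f≤g = ℕ.+-mono-≤ (f≤g zero) (∑-mono-≤ (f≤g ∘ suc))

∑-mono-≤-≡⇒≡ : {f g : Fin n → ℕ} → (∀ i → f i ℕ.≤ g i) → sum f ≡ sum g → ∀ i → f i ≡ g i
∑-mono-≤-≡⇒≡ {suc n} {f} {g} f≤g ∑f≡∑g = λ where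
    zero    → head≡
    (suc i) → ∑-mono-≤-≡⇒≡ (f≤g ∘ suc) tail≡ i
  where
  head≡ : f zero ≡ g zero
  head≡ = ℕ.≤-antisym (f≤g zero) (ℕ.+-cancelʳ-≤ _ _ _ (begin
    g zero ℕ.+ sum (f ∘ suc) ≤⟨ ℕ.+-monoʳ-≤ (g zero) (∑-mono-≤ (f≤g ∘ suc)) ⟩
    g zero ℕ.+ sum (g ∘ suc) ≡⟨ sym ∑f≡∑g ⟩
    f zero ℕ.+ sum (f ∘ suc) ∎))
    where open ℕ.≤-Reasoning
  tail≡ : sum (f ∘ suc) ≡ sum (g ∘ suc)
  tail≡ = ℕ.+-cancelˡ-≡ (g zero) _ _ (trans (cong (ℕ._+ _) (sym head≡)) ∑f≡∑g)

sumᴸ-map-tabulate : ∀ {A : Set} (f : A → ℕ) (g : Fin n → A) →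
                    sumᴸ (map f (tabulate g)) ≡ sum (f ∘ g)
sumᴸ-map-tabulate {zero}  f g = refl
sumᴸ-map-tabulate {suc n} f g = cong (f (g zero) ℕ.+_) (sumᴸ-map-tabulate f (g ∘ suc))

indicator : Bool → ℕ
indicator b = if b then 1 else 0

indicator-∧-≤ : ∀ a b → indicator (a ∧ b) ℕ.≤ indicator a
indicator-∧-≤ true  true  = ℕ.≤-refl
indicator-∧-≤ true  false = z≤n
indicator-∧-≤ false b     = z≤n

indicator-∧-≡⇔ : ∀ a b → indicator (a ∧ b) ≡ indicator a ⇔ (T a → T b)
indicator-∧-≡⇔ true  true  = mk⇔ (λ _ _ → _) (λ _ → refl)
indicator-∧-≡⇔ true  false = mk⇔ (λ ()) (λ a⇒b → ⊥-elim (a⇒b _))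
indicator-∧-≡⇔ false b     = mk⇔ (λ _ ()) (λ _ → refl)

count² : (Fin n → Fin n → Bool) → ℕ
count² {n} P = ∑[ i < n ] ∑[ j < n ] indicator (P i j)

count²-∧-≤ : (P Q : Fin n → Fin n → Bool) → count² (λ i j → P i j ∧ Q i j) ℕ.≤ count² P
count²-∧-≤ P Q = ∑-mono-≤ λ i → ∑-mono-≤ λ j → indicator-∧-≤ (P i j) (Q i j)

count²-∧-≡⇔ : (P Q : Fin n → Fin n → Bool) →
              count² (λ i j → P i j ∧ Q i j) ≡ count² P ⇔ (∀ i j → T (P i j) → T (Q i j))
count²-∧-≡⇔ P Q = mk⇔
  (λ eq i j → to (indicator-∧-≡⇔ (P i j) (Q i j))
    (∑-mono-≤-≡⇒≡ (λ j → indicator-∧-≤ (P i j) (Q i j))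
      (∑-mono-≤-≡⇒≡ (λ i → ∑-mono-≤ λ j → indicator-∧-≤ (P i j) (Q i j)) eq i) j))
  (λ P⇒Q → sum-cong-≗ λ i → sum-cong-≗ λ j → from (indicator-∧-≡⇔ (P i j) (Q i j)) (P⇒Q i j))

∣∣≡∑ : (U : Subset n) → ∣ U ∣ ≡ ∑[ i < n ] indicator (lookup U i)
∣∣≡∑ []          = refl
∣∣≡∑ (true  ∷ U) = cong suc (∣∣≡∑ U)
∣∣≡∑ (false ∷ U) = ∣∣≡∑ U

∈⇔T-lookup : {U : Subset n} {i : Fin n} → i ∈ U ⇔ T (lookup U i)
∈⇔T-lookup {U = U} {i} = mk⇔ (from T-≡ ∘ []=⇒lookup) (lookup⇒[]= i U ∘ to T-≡)

isPair : Subset n → Fin n → Fin n → Bool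
isPair U i j = (toℕ i <ᵇ toℕ j) ∧ lookup U i ∧ lookup U j

pairs : Subset n → ℕ
pairs U = count² (isPair U)

-- The row i = 0 of pairs (x ∷ U) counts the j ∈ U when x = true and nothing otherwise;
-- the remaining rows add up to pairs U.
pairs-formula : (U : Subset n) → pairs U ℕ.* 2 ℕ.+ ∣ U ∣ ≡ ∣ U ∣ ℕ.* ∣ U ∣
pairs-formula []                  = refl
pairs-formula {suc n} (false ∷ U) rewrite sum-replicate-zero n = pairs-formula U
pairs-formula (true ∷ U) rewrite sym (∣∣≡∑ U) = begin
    (s ℕ.+ pairs U) ℕ.* 2 ℕ.+ suc s         ≡⟨ regroup s (pairs U) ⟩
    (pairs U ℕ.* 2 ℕ.+ s) ℕ.+ suc (s ℕ.+ s) ≡⟨ cong (ℕ._+ suc (s ℕ.+ s)) (pairs-formula U) ⟩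
    s ℕ.* s ℕ.+ suc (s ℕ.+ s)               ≡⟨ square-suc s ⟩
    suc s ℕ.* suc s                         ∎
  where
  open ≡-Reasoning
  open +-*-Solver
  s = ∣ U ∣
  regroup : ∀ s t → (s ℕ.+ t) ℕ.* 2 ℕ.+ suc s ≡ (t ℕ.* 2 ℕ.+ s) ℕ.+ suc (s ℕ.+ s)
  regroup = solve 2 (λ s t → (s :+ t) :* con 2 :+ (con 1 :+ s) := (t :* con 2 :+ s) :+ (con 1 :+ (s :+ s))) refl
  square-suc : ∀ s → s ℕ.* s ℕ.+ suc (s ℕ.+ s) ≡ suc s ℕ.* suc s
  square-suc = solve 1 (λ s → s :* s :+ (con 1 :+ (s :+ s)) := (con 1 :+ s) :* (con 1 :+ s)) refl

pairs-of-size : ∀ {k} (U : Subset n) → ∣ U ∣ ≡ suc k → pairs U ℕ.* 2 ≡ k ℕ.* suc k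
pairs-of-size {k = k} U ∣U∣≡1+k = ℕ.+-cancelʳ-≡ (suc k) _ _ (begin
  pairs U ℕ.* 2 ℕ.+ suc k ≡⟨ subst (λ s → pairs U ℕ.* 2 ℕ.+ s ≡ s ℕ.* s) ∣U∣≡1+k (pairs-formula U) ⟩
  suc k ℕ.* suc k         ≡⟨ ℕ.+-comm (suc k) (k ℕ.* suc k) ⟩
  k ℕ.* suc k ℕ.+ suc k   ∎)
  where open ≡-Reasoning

edges≡count² : (G : Graph n) (U : Subset n) → edges G U ≡ count² (λ i j → isPair U i j ∧ adj G i j)
edges≡count² {n} G U = begin
    edges G U
  ≡⟨ sumᴸ-map-tabulate (λ i → sumᴸ (map (λ j → indicator (edgeIn i j)) (tabulate id))) id ⟩
    ∑[ i < n ] sumᴸ (map (λ j → indicator (edgeIn i j)) (tabulate id))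
  ≡⟨ sum-cong-≗ (λ i → sumᴸ-map-tabulate (λ j → indicator (edgeIn i j)) id) ⟩
    ∑[ i < n ] ∑[ j < n ] indicator (edgeIn i j)
  ≡⟨ sum-cong-≗ (λ i → sum-cong-≗ λ j → cong indicator (reassociate i j)) ⟩
    count² (λ i j → isPair U i j ∧ adj G i j)
  ∎
  where
  open ≡-Reasoning
  edgeIn : Fin n → Fin n → Bool
  edgeIn i j = (toℕ i <ᵇ toℕ j) ∧ lookup U i ∧ lookup U j ∧ adj G i j
  reassociate : ∀ i j → edgeIn i j ≡ isPair U i j ∧ adj G i j
  reassociate i j = sym (trans (∧-assoc (toℕ i <ᵇ toℕ j) _ _) (cong ((toℕ i <ᵇ toℕ j) ∧_) (∧-assoc (lookup U i) _ _)))

edges≤pairs : (G : Graph n) (U : Subset n) → edges G U ℕ.≤ pairs U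
edges≤pairs G U = subst (ℕ._≤ pairs U) (sym (edges≡count² G U)) (count²-∧-≤ (isPair U) (adj G))

T-isPair⇔ : {U : Subset n} {i j : Fin n} → T (isPair U i j) ⇔ (toℕ i ℕ.< toℕ j × i ∈ U × j ∈ U)
T-isPair⇔ {i = i} {j} = mk⇔
  (λ p → let i<j , i∈U∧j∈U = to T-∧ p ; i∈U , j∈U = to T-∧ i∈U∧j∈U in
         ℕ.<ᵇ⇒< (toℕ i) (toℕ j) i<j , from ∈⇔T-lookup i∈U , from ∈⇔T-lookup j∈U)
  (λ (i<j , i∈U , j∈U) → from T-∧ (ℕ.<⇒<ᵇ i<j , from T-∧ (to ∈⇔T-lookup i∈U , to ∈⇔T-lookup j∈U)))

clique⇔pairs-adjacent : (G : Graph n) (U : Subset n) →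
                        IsClique G U ⇔ (∀ i j → T (isPair U i j) → T (adj G i j))
clique⇔pairs-adjacent G U = mk⇔
  (λ clique i j p → let i<j , i∈U , j∈U = to T-isPair⇔ p in
    from T-≡ (clique i j i∈U j∈U λ { refl → ℕ.<-irrefl refl i<j }))
  (λ adjacent i j i∈U j∈U i≢j → to T-≡ (adjacent′ adjacent i j i∈U j∈U i≢j))
  where
  adjacent′ : (∀ i j → T (isPair U i j) → T (adj G i j)) →
              ∀ i j → i ∈ U → j ∈ U → i ≢ j → T (adj G i j)
  adjacent′ adjacent i j i∈U j∈U i≢j with ℕ.<-cmp (toℕ i) (toℕ j)
  ... | tri< i<j _ _ = adjacent i j (from T-isPair⇔ (i<j , i∈U , j∈U))
  ... | tri≈ _ i≡j _ = ⊥-elim (i≢j (toℕ-injective i≡j))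
  ... | tri> _ _ j<i = subst T (Graph.sym G j i) (adjacent j i (from T-isPair⇔ (j<i , j∈U , i∈U)))

clique⇔edges≡pairs : (G : Graph n) (U : Subset n) → IsClique G U ⇔ edges G U ≡ pairs U
clique⇔edges≡pairs G U = mk⇔
  (λ clique → trans (edges≡count² G U) (from (count²-∧-≡⇔ (isPair U) (adj G)) (to (clique⇔pairs-adjacent G U) clique)))
  (λ e≡p → from (clique⇔pairs-adjacent G U) (to (count²-∧-≡⇔ (isPair U) (adj G)) (trans (sym (edges≡count² G U)) e≡p)))

-- p / suc b unfolds to fromℚᵘ (mkℚᵘ p b).
toℚᵘ-/ : ∀ (p : ℤ) b → toℚᵘ (p / suc b) ℚᵘ.≃ mkℚᵘ p b
toℚᵘ-/ p b = toℚᵘ-fromℚᵘ (mkℚᵘ p b)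

/-≤⇔*-≤ : ∀ a b c d → (+ a) / suc b ≤ (+ c) / suc d ⇔ a ℕ.* suc d ℕ.≤ c ℕ.* suc b
/-≤⇔*-≤ a b c d = mk⇔ to′ from′
  where
  to′ : (+ a) / suc b ≤ (+ c) / suc d → a ℕ.* suc d ℕ.≤ c ℕ.* suc b
  to′ p≤q with ℚᵘ.≤-respʳ-≃ (toℚᵘ-/ (+ c) d) (ℚᵘ.≤-respˡ-≃ (toℚᵘ-/ (+ a) b) (toℚᵘ-mono-≤ p≤q))
  ... | *≤* le rewrite sym (ℤ.pos-* a (suc d)) | sym (ℤ.pos-* c (suc b)) = ℤ.drop‿+≤+ le
  from′ : a ℕ.* suc d ℕ.≤ c ℕ.* suc b → (+ a) / suc b ≤ (+ c) / suc d
  from′ le = toℚᵘ-cancel-≤ (ℚᵘ.≤-respʳ-≃ (ℚᵘ.≃-sym (toℚᵘ-/ (+ c) d))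
    (ℚᵘ.≤-respˡ-≃ (ℚᵘ.≃-sym (toℚᵘ-/ (+ a) b)) (*≤* le′)))
    where
    le′ : + a ℤ.* + suc d ℤ.≤ + c ℤ.* + suc b
    le′ rewrite sym (ℤ.pos-* a (suc d)) | sym (ℤ.pos-* c (suc b)) = ℤ.+≤+ le

half-≤⇔ : ∀ a b → (+ a) / 2 ≤ (+ b) / 2 ⇔ a ℕ.≤ b
half-≤⇔ a b = mk⇔ (ℕ.*-cancelʳ-≤ a b 2 ∘ to (/-≤⇔*-≤ a 1 b 1)) (from (/-≤⇔*-≤ a 1 b 1) ∘ ℕ.*-monoˡ-≤ 2)

half-+ : ∀ a b → (+ a) / 2 + (+ b) / 2 ≡ (+ (a ℕ.+ b)) / 2
half-+ a b = toℚᵘ-injective (begin-equality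
    toℚᵘ ((+ a) / 2 + (+ b) / 2)           ≃⟨ toℚᵘ-homo-+ ((+ a) / 2) ((+ b) / 2) ⟩
    toℚᵘ ((+ a) / 2) ℚᵘ.+ toℚᵘ ((+ b) / 2) ≃⟨ ℚᵘ.+-cong (toℚᵘ-/ (+ a) 1) (toℚᵘ-/ (+ b) 1) ⟩
    mkℚᵘ (+ a) 1 ℚᵘ.+ mkℚᵘ (+ b) 1        ≃⟨ *≡* cross ⟩
    mkℚᵘ (+ (a ℕ.+ b)) 1                 ≃⟨ ℚᵘ.≃-sym (toℚᵘ-/ (+ (a ℕ.+ b)) 1) ⟩
    toℚᵘ ((+ (a ℕ.+ b)) / 2)               ∎)
  where
  open ℚᵘ.≤-Reasoning
  open ℤ-Solver
  cross : (+ a ℤ.* + 2 ℤ.+ + b ℤ.* + 2) ℤ.* + 2 ≡ + (a ℕ.+ b) ℤ.* + 4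
  cross rewrite ℤ.pos-+ a b = solve 2 (λ x y → (x :* con (+ 2) :+ y :* con (+ 2)) :* con (+ 2) := (x :+ y) :* con (+ 4)) refl (+ a) (+ b)

halves-+₃ : ∀ a b c → (+ a) / 2 + (+ b) / 2 + (+ c) / 2 ≡ (+ (a ℕ.+ b ℕ.+ c)) / 2
halves-+₃ a b c = trans (cong (_+ (+ c) / 2) (half-+ a b)) (half-+ (a ℕ.+ b) c)

+-mono-≤-tight : ∀ {p p′ q q′ : ℚ} → p ≤ p′ → q ≤ q′ → p′ + q′ ≤ p + q → p′ ≤ p × q′ ≤ q
+-mono-≤-tight p≤p′ q≤q′ p′+q′≤p+q =
  ≮⇒≥ (λ p<p′ → <-irrefl refl (<-≤-trans (+-mono-<-≤ p<p′ q≤q′) p′+q′≤p+q)) ,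
  ≮⇒≥ (λ q<q′ → <-irrefl refl (<-≤-trans (+-mono-≤-< p≤p′ q<q′) p′+q′≤p+q))

+-mono-≤-tight₃ : ∀ {p p′ q q′ r r′ : ℚ} → p ≤ p′ → q ≤ q′ → r ≤ r′ →
                  p′ + q′ + r′ ≤ p + q + r → p′ ≤ p × q′ ≤ q × r′ ≤ r
+-mono-≤-tight₃ p≤p′ q≤q′ r≤r′ sum′≤sum
  with p+q′≤p+q , r′≤r ← +-mono-≤-tight (+-mono-≤ p≤p′ q≤q′) r≤r′ sum′≤sum
  with p′≤p , q′≤q ← +-mono-≤-tight p≤p′ q≤q′ p+q′≤p+q
  = p′≤p , q′≤q , r′≤r

density-of-size : ∀ {k} (G : Graph n) (U : Subset n) → ∣ U ∣ ≡ suc k → density G U ≡ (+ edges G U) / suc k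
density-of-size G U ∣U∣≡1+k with ∣ U ∣
density-of-size G U refl | _ = refl

density≤half : ∀ {k} (G : Graph n) (U : Subset n) → ∣ U ∣ ≡ suc k → density G U ≤ (+ k) / 2
density≤half {k = k} G U ∣U∣≡1+k = subst (_≤ (+ k) / 2) (sym (density-of-size G U ∣U∣≡1+k))
  (from (/-≤⇔*-≤ (edges G U) k k 1)
    (subst (edges G U ℕ.* 2 ℕ.≤_) (pairs-of-size U ∣U∣≡1+k) (ℕ.*-monoˡ-≤ 2 (edges≤pairs G U))))

clique⇒density≡half : ∀ {k} (G : Graph n) (U : Subset n) → ∣ U ∣ ≡ suc k →
                      IsClique G U → density G U ≡ (+ k) / 2
clique⇒density≡half {k = k} G U ∣U∣≡1+k clique = ≤-antisym (density≤half G U ∣U∣≡1+k)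
  (subst ((+ k) / 2 ≤_) (sym (density-of-size G U ∣U∣≡1+k))
    (from (/-≤⇔*-≤ k 1 (edges G U) k)
      (ℕ.≤-reflexive (trans (sym (pairs-of-size U ∣U∣≡1+k)) (cong (ℕ._* 2) (sym (to (clique⇔edges≡pairs G U) clique)))))))

half≤density⇒clique : ∀ {k} (G : Graph n) (U : Subset n) → ∣ U ∣ ≡ suc k →
                      (+ k) / 2 ≤ density G U → IsClique G U
half≤density⇒clique {k = k} G U ∣U∣≡1+k half≤d = from (clique⇔edges≡pairs G U)
  (ℕ.≤-antisym (edges≤pairs G U) (ℕ.*-cancelʳ-≤ (pairs U) (edges G U) 2
    (subst (ℕ._≤ edges G U ℕ.* 2) (sym (pairs-of-size U ∣U∣≡1+k))
      (to (/-≤⇔*-≤ k 1 (edges G U) k) (subst ((+ k) / 2 ≤_) (density-of-size G U ∣U∣≡1+k) half≤d)))))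

nonempty⇒∣∣≡suc : {U : Subset n} → Nonempty U → ∃[ k ] ∣ U ∣ ≡ suc k
nonempty⇒∣∣≡suc {U = true  ∷ U} _                      = ∣ U ∣ , refl
nonempty⇒∣∣≡suc {U = false ∷ U} (suc v , there v∈U) = nonempty⇒∣∣≡suc (v , v∈U)

disjoint-∷ : ∀ {x y} {A B : Subset n} → Disjoint (x ∷ A) (y ∷ B) → Disjoint A B
disjoint-∷ A⊥B v v∈A v∈B = A⊥B (suc v) (there v∈A) (there v∈B)

∪-disjoint : {A B C : Subset n} → Disjoint A C → Disjoint B C → Disjoint (A ∪ B) C
∪-disjoint {A = A} {B} A⊥C B⊥C v v∈A∪B v∈C = Sum.[ (λ v∈A → A⊥C v v∈A v∈C) , (λ v∈B → B⊥C v v∈B v∈C) ] (x∈p∪q⁻ A B v∈A∪B)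

∣∪∣≡∣∣+∣∣ : (A B : Subset n) → Disjoint A B → ∣ A ∪ B ∣ ≡ ∣ A ∣ ℕ.+ ∣ B ∣
∣∪∣≡∣∣+∣∣ []          []          _   = refl
∣∪∣≡∣∣+∣∣ (true  ∷ A) (true  ∷ B) A⊥B = ⊥-elim (A⊥B zero here here)
∣∪∣≡∣∣+∣∣ (true  ∷ A) (false ∷ B) A⊥B = cong suc (∣∪∣≡∣∣+∣∣ A B (disjoint-∷ A⊥B))
∣∪∣≡∣∣+∣∣ (false ∷ A) (true  ∷ B) A⊥B = trans (cong suc (∣∪∣≡∣∣+∣∣ A B (disjoint-∷ A⊥B))) (sym (ℕ.+-suc ∣ A ∣ ∣ B ∣))
∣∪∣≡∣∣+∣∣ (false ∷ A) (false ∷ B) A⊥B = ∣∪∣≡∣∣+∣∣ A B (disjoint-∷ A⊥B)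

∣∣≡n⇔covers : (U : Subset n) → ∣ U ∣ ≡ n ⇔ (∀ v → v ∈ U)
∣∣≡n⇔covers {n} U = mk⇔
  (λ ∣U∣≡n v → subst (v ∈_) (sym (∣p∣≡n⇒p≡⊤ ∣U∣≡n)) ∈⊤)
  (λ covers → trans (cong ∣_∣ (⊆-antisym ⊆⊤ (λ {v} _ → covers v))) (∣⊤∣≡n n))

∈-∪₃⇔ : {A B C : Subset n} {v : Fin n} → v ∈ (A ∪ B) ∪ C ⇔ (v ∈ A ⊎ v ∈ B ⊎ v ∈ C)
∈-∪₃⇔ {A = A} {B} {C} = mk⇔
  (λ v∈ → Sum.assocʳ (Sum.map₁ (x∈p∪q⁻ A B) (x∈p∪q⁻ (A ∪ B) C v∈)))
  (λ v∈ → x∈p∪q⁺ (Sum.map₁ x∈p∪q⁺ (Sum.assocˡ v∈)))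

∣∪₃∣ : ∀ {a b c} (A B C : Subset n) → ThreeDisjoint A B C →
       ∣ A ∣ ≡ suc a → ∣ B ∣ ≡ suc b → ∣ C ∣ ≡ suc c → ∣ (A ∪ B) ∪ C ∣ ≡ 3 ℕ.+ (a ℕ.+ b ℕ.+ c)
∣∪₃∣ {a = a} {b} {c} A B C (_ , _ , _ , A⊥B , A⊥C , B⊥C) ∣A∣≡ ∣B∣≡ ∣C∣≡ = begin
  ∣ (A ∪ B) ∪ C ∣                ≡⟨ ∣∪∣≡∣∣+∣∣ (A ∪ B) C (∪-disjoint A⊥C B⊥C) ⟩
  ∣ A ∪ B ∣ ℕ.+ ∣ C ∣            ≡⟨ cong (ℕ._+ ∣ C ∣) (∣∪∣≡∣∣+∣∣ A B A⊥B) ⟩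
  ∣ A ∣ ℕ.+ ∣ B ∣ ℕ.+ ∣ C ∣      ≡⟨ cong₂ ℕ._+_ (cong₂ ℕ._+_ ∣A∣≡ ∣B∣≡) ∣C∣≡ ⟩
  suc a ℕ.+ suc b ℕ.+ suc c      ≡⟨ solve 3 (λ a b c → (con 1 :+ a) :+ (con 1 :+ b) :+ (con 1 :+ c) := con 3 :+ (a :+ b :+ c)) refl a b c ⟩
  3 ℕ.+ (a ℕ.+ b ℕ.+ c)          ∎
  where
  open ≡-Reasoning
  open +-*-Solver

partition-into-cliques⇒dense : ∀ {k₁ k₂ k₃} (G : Graph n) {V₁ V₂ V₃ : Subset n} →
  ∣ V₁ ∣ ≡ suc k₁ → ∣ V₂ ∣ ≡ suc k₂ → ∣ V₃ ∣ ≡ suc k₃ →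
  IsPartition3 V₁ V₂ V₃ → IsClique G V₁ → IsClique G V₂ → IsClique G V₃ →
  (+ n - + 3) / 2 ≤ density G V₁ + density G V₂ + density G V₃
partition-into-cliques⇒dense {n} {k₁} {k₂} {k₃} G {V₁} {V₂} {V₃} s₁ s₂ s₃ (disjoint , covers) K₁ K₂ K₃ =
  ≤-reflexive (begin
    (+ n - + 3) / 2                                       ≡⟨ cong (λ m → (+ m - + 3) / 2) n≡3+K ⟩
    (+ (k₁ ℕ.+ k₂ ℕ.+ k₃)) / 2                            ≡⟨ sym (halves-+₃ k₁ k₂ k₃) ⟩
    (+ k₁) / 2 + (+ k₂) / 2 + (+ k₃) / 2                  ≡⟨ sym (cong₂ _+_ (cong₂ _+_ half₁ half₂) half₃) ⟩
    density G V₁ + density G V₂ + density G V₃            ∎)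
  where
  open ≡-Reasoning
  half₁ : density G V₁ ≡ (+ k₁) / 2
  half₁ = clique⇒density≡half G V₁ s₁ K₁
  half₂ : density G V₂ ≡ (+ k₂) / 2
  half₂ = clique⇒density≡half G V₂ s₂ K₂
  half₃ : density G V₃ ≡ (+ k₃) / 2
  half₃ = clique⇒density≡half G V₃ s₃ K₃
  n≡3+K : n ≡ 3 ℕ.+ (k₁ ℕ.+ k₂ ℕ.+ k₃)
  n≡3+K = trans (sym (from (∣∣≡n⇔covers ((V₁ ∪ V₂) ∪ V₃)) (λ v → from ∈-∪₃⇔ (covers v))))
                (∣∪₃∣ V₁ V₂ V₃ disjoint s₁ s₂ s₃)

dense⇒partition-into-cliques : ∀ {k₁ k₂ k₃} (G : Graph n) {U₁ U₂ U₃ : Subset n} →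
  ∣ U₁ ∣ ≡ suc k₁ → ∣ U₂ ∣ ≡ suc k₂ → ∣ U₃ ∣ ≡ suc k₃ → ThreeDisjoint U₁ U₂ U₃ →
  (+ n - + 3) / 2 ≤ density G U₁ + density G U₂ + density G U₃ →
  IsPartition3 U₁ U₂ U₃ × IsClique G U₁ × IsClique G U₂ × IsClique G U₃
dense⇒partition-into-cliques {n} {k₁} {k₂} {k₃} G {U₁} {U₂} {U₃} s₁ s₂ s₃ disjoint dense =
  (disjoint , λ v → to ∈-∪₃⇔ (to (∣∣≡n⇔covers W) ∣W∣≡n v)) , cliques halves≤densities
  where
  W : Subset n
  W = (U₁ ∪ U₂) ∪ U₃
  K : ℕ
  K = k₁ ℕ.+ k₂ ℕ.+ k₃
  d : ℚ
  d = density G U₁ + density G U₂ + density G U₃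
  ∣W∣≡3+K : ∣ W ∣ ≡ 3 ℕ.+ K
  ∣W∣≡3+K = ∣∪₃∣ U₁ U₂ U₃ disjoint s₁ s₂ s₃
  r : ℕ
  r = proj₁ (ℕ.m≤n⇒∃[o]m+o≡n (∣p∣≤n W))
  ∣W∣+r≡n : ∣ W ∣ ℕ.+ r ≡ n
  ∣W∣+r≡n = proj₂ (ℕ.m≤n⇒∃[o]m+o≡n (∣p∣≤n W))
  -- (+ (3 + m) - + 3) reduces to + m.
  dense′ : (+ (K ℕ.+ r)) / 2 ≤ d
  dense′ = subst (λ m → (+ m - + 3) / 2 ≤ d) (trans (sym ∣W∣+r≡n) (cong (ℕ._+ r) ∣W∣≡3+K)) dense
  d≤half : d ≤ (+ K) / 2
  d≤half = subst (d ≤_) (halves-+₃ k₁ k₂ k₃)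
    (+-mono-≤ (+-mono-≤ (density≤half G U₁ s₁) (density≤half G U₂ s₂)) (density≤half G U₃ s₃))
  r≡0 : r ≡ 0
  r≡0 = ℕ.n≤0⇒n≡0 (ℕ.+-cancelˡ-≤ K r 0
    (subst (K ℕ.+ r ℕ.≤_) (sym (ℕ.+-identityʳ K)) (to (half-≤⇔ (K ℕ.+ r) K) (≤-trans dense′ d≤half))))
  ∣W∣≡n : ∣ W ∣ ≡ n
  ∣W∣≡n = trans (sym (ℕ.+-identityʳ ∣ W ∣)) (subst (λ r → ∣ W ∣ ℕ.+ r ≡ n) r≡0 ∣W∣+r≡n)
  halves≤d : (+ k₁) / 2 + (+ k₂) / 2 + (+ k₃) / 2 ≤ d
  halves≤d = subst (_≤ d) (sym (halves-+₃ k₁ k₂ k₃)) (≤-trans (from (half-≤⇔ K (K ℕ.+ r)) (ℕ.m≤m+n K r)) dense′)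
  halves≤densities : (+ k₁) / 2 ≤ density G U₁ × (+ k₂) / 2 ≤ density G U₂ × (+ k₃) / 2 ≤ density G U₃
  halves≤densities = +-mono-≤-tight₃ (density≤half G U₁ s₁) (density≤half G U₂ s₂) (density≤half G U₃ s₃) halves≤d
  cliques : (+ k₁) / 2 ≤ density G U₁ × (+ k₂) / 2 ≤ density G U₂ × (+ k₃) / 2 ≤ density G U₃ →
            IsClique G U₁ × IsClique G U₂ × IsClique G U₃
  cliques (h₁ , h₂ , h₃) = half≤density⇒clique G U₁ s₁ h₁ , half≤density⇒clique G U₂ s₂ h₂ , half≤density⇒clique G U₃ s₃ h₃

lemma5 : ∀ (n : ℕ) (G : Graph n) →
    (Σ[ V₁ ∈ Subset n ] Σ[ V₂ ∈ Subset n ] Σ[ V₃ ∈ Subset n ]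
      (IsPartition3 V₁ V₂ V₃ × IsClique G V₁ × IsClique G V₂ × IsClique G V₃))
    ⇔
    (Σ[ U₁ ∈ Subset n ] Σ[ U₂ ∈ Subset n ] Σ[ U₃ ∈ Subset n ]
      (ThreeDisjoint U₁ U₂ U₃ ×
       ((+ n - + 3) / 2) ≤ (density G U₁ + density G U₂ + density G U₃)))
lemma5 n G = mk⇔
  (λ (V₁ , V₂ , V₃ , partition@((ne₁ , ne₂ , ne₃ , _) , _) , K₁ , K₂ , K₃) →
    V₁ , V₂ , V₃ , proj₁ partition ,
    partition-into-cliques⇒dense G (size ne₁) (size ne₂) (size ne₃) partition K₁ K₂ K₃)
  (λ (U₁ , U₂ , U₃ , disjoint@(ne₁ , ne₂ , ne₃ , _) , dense) →
    U₁ , U₂ , U₃ , dense⇒partition-into-cliques G (size ne₁) (size ne₂) (size ne₃) disjoint dense)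
  where
  size : {U : Subset n} (nonempty : Nonempty U) → ∣ U ∣ ≡ suc (proj₁ (nonempty⇒∣∣≡suc nonempty))
  size = proj₂ ∘ nonempty⇒∣∣≡suc
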